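{- Let $S$ be a string of length $n$ in which every character occurs at least twice, let $\sigma$ be a character of $S$ occurring $\ell\ge 2$ times, at positions $i_1<i_2<\dots<i_\ell$, and let $e=\lfloor \ell/2\rfloor$. Let $Y$ be any maximal common subsequence of $S[i_1,i_{e+1})$ and $S[i_{e+1},n]$ that contains $\sigma^e$ as a subsequence. If $\ell$ is odd and $Y$ is a subsequence of $S[i_{e+2},n]$, replace $Y$ by any maximal common subsequence of $S[i_1,i_{e+2})$ and $S[i_{e+2},n]$ that contains (the old) $Y$ as a subsequence. Then the first character of the resulting $Y$ is $\sigma$.
   Context: For a string $S$, $S[i]$ is its $i$-th character, $S[i,j]=S[i]S[i+1]\cdots S[j]$ (empty if $j<i$), $S[i,j)=S[i,j-1]$, $S(i,j]=S[i+1,j]$. $\sigma^e$ is the string of $e$ copies of $\sigma$. A common subsequence $C$ of strings $S_1,S_2$ is maximal if no common subsequence of $S_1$ and $S_2$ properly contains $C$ as a subsequence. -}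

module Defs where

open import Level using (Level)
open import Data.Nat using (ℕ; zero; suc; _∸_)
open import Data.List using (List; []; _∷_; take; drop)
open import Data.Maybe using (Maybe; just; nothing)
open import Data.Product using (_×_)
open import Relation.Binary.PropositionalEquality using (_≡_)
open import Data.List.Relation.Binary.Sublist.Propositional using (_⊆_)

private variable
  a : Level
  A : Set a

-- 1-indexed character access: charAt S i = just S[i] if 1 ≤ i ≤ |S|, else nothing.
charAt : List A → ℕ → Maybe A
charAt S zero = nothing
charAt [] (suc i) = nothing
charAt (x ∷ S) (suc zero) = just x
charAt (x ∷ S) (suc (suc i)) = charAt S (suc i)

-- S[i, j) = S[i] ... S[j-1]  (1-indexed; empty if j ≤ i)
substrCO : List A → ℕ → ℕ → List A
substrCO S i j = take (j ∸ i) (drop (i ∸ 1) S)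

-- S[i, n] where n = |S|  (1-indexed suffix)
suffixFrom : List A → ℕ → List A
suffixFrom S i = drop (i ∸ 1) S

CommonSubseq : List A → List A → List A → Set _
CommonSubseq C S₁ S₂ = (C ⊆ S₁) × (C ⊆ S₂)

MaximalCommonSubseq : List A → List A → List A → Set _
MaximalCommonSubseq C S₁ S₂ =
  CommonSubseq C S₁ S₂ × (∀ C′ → CommonSubseq C′ S₁ S₂ → C ⊆ C′ → C′ ≡ C)

{-# OPTIONS --safe #-}
module Submission where

open import Defs
open import Level using (Level)
open import Data.Nat using (ℕ; zero; suc; _≤_; _<_; _%_; ⌊_/2⌋; z≤n; s≤s)
open import Data.Nat.Properties using (<-trans; ≤-trans; <⇒≤; m≤n⇒m<n∨m≡n; m<n⇒0<n∸m; 1+n≢n; ⌊n/2⌋≤n; ⌊n/2⌋<n)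
open import Data.List using (List; []; _∷_; replicate; head; take; length)
open import Data.Maybe using (just)
open import Data.Product using (_×_; ∃; _,_)
open import Data.Sum using (inj₁; inj₂)
open import Relation.Binary.PropositionalEquality using (_≡_; _≢_; refl; cong; trans)
open import Relation.Nullary using (¬_; contradiction)
open import Data.List.Relation.Binary.Sublist.Heterogeneous using (_∷ʳ_; _∷_; minimum)
open import Data.List.Relation.Binary.Sublist.Propositional using (_⊆_; ⊆-refl)

-- Both compared strings start at an occurrence of σ, and a maximal common
-- subsequence of two strings with the same first character must begin with
-- it: otherwise prepending that character would give a larger one.

private variable
  a : Level
  A : Set a
  x : A
  P Q Y : List A

head-maximalCommonSubseq : head P ≡ just x → head Q ≡ just x →
                           MaximalCommonSubseq Y P Q → head Y ≡ just x
head-maximalCommonSubseq {P = _ ∷ P} {x = x} {Q = _ ∷ Q} {Y = []} refl refl (_ , maximal)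
  with () ← maximal (x ∷ []) (refl ∷ minimum P , refl ∷ minimum Q) (minimum _)
head-maximalCommonSubseq {P = _ ∷ _} {Q = _ ∷ _} {Y = _ ∷ _} refl refl ((y≡x ∷ _ , _) , _) =
  cong just y≡x
head-maximalCommonSubseq {P = _ ∷ _} {Q = _ ∷ _} {Y = _ ∷ _} refl refl ((_ , y≡x ∷ _) , _) =
  cong just y≡x
head-maximalCommonSubseq {P = _ ∷ _} {x = x} {Q = _ ∷ _} {Y = y ∷ Y} refl refl
                         ((_ ∷ʳ Y⊆P , _ ∷ʳ Y⊆Q) , maximal) =
  contradiction (cong length (maximal (x ∷ y ∷ Y) (refl ∷ Y⊆P , refl ∷ Y⊆Q) (x ∷ʳ ⊆-refl))) 1+n≢n

head-take : ∀ {n} (xs : List A) → 0 < n → head (take n xs) ≡ head xs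
head-take {n = suc _} []      _ = refl
head-take {n = suc _} (_ ∷ _) _ = refl

charAt⇒head-suffixFrom : ∀ (S : List A) i → charAt S i ≡ just x → head (suffixFrom S i) ≡ just x
charAt⇒head-suffixFrom S       zero          ()
charAt⇒head-suffixFrom []      (suc i)       ()
charAt⇒head-suffixFrom (_ ∷ _) (suc zero)    S[i]≡x = S[i]≡x
charAt⇒head-suffixFrom (_ ∷ S) (suc (suc i)) S[i]≡x = charAt⇒head-suffixFrom S (suc i) S[i]≡x

charAt⇒head-substrCO : ∀ (S : List A) {i j} → i < j → charAt S i ≡ just x → head (substrCO S i j) ≡ just x
charAt⇒head-substrCO S {i} i<j S[i]≡x =
  trans (head-take (suffixFrom S i) (m<n⇒0<n∸m i<j)) (charAt⇒head-suffixFrom S i S[i]≡x)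

head-maximalCommonSubseq-between : ∀ (S : List A) {i j} → i < j →
  charAt S i ≡ just x → charAt S j ≡ just x →
  MaximalCommonSubseq Y (substrCO S i j) (suffixFrom S j) → head Y ≡ just x
head-maximalCommonSubseq-between S {j = j} i<j S[i]≡x S[j]≡x =
  head-maximalCommonSubseq (charAt⇒head-substrCO S i<j S[i]≡x) (charAt⇒head-suffixFrom S j S[j]≡x)

StrictlyIncreasingOn : (ℕ → ℕ) → ℕ → Set
StrictlyIncreasingOn f ℓ = ∀ k → 1 ≤ k → k < ℓ → f k < f (suc k)

strictlyIncreasingOn⇒< : ∀ {f ℓ} → StrictlyIncreasingOn f ℓ →
                          ∀ {i j} → 1 ≤ i → i < j → j ≤ ℓ → f i < f j
strictlyIncreasingOn⇒< inc {i} {suc j} 1≤i (s≤s i≤j) j<ℓ with m≤n⇒m<n∨m≡n i≤j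
... | inj₁ i<j  = <-trans (strictlyIncreasingOn⇒< inc 1≤i i<j (<⇒≤ j<ℓ)) (inc j (≤-trans 1≤i i≤j) j<ℓ)
... | inj₂ refl = inc i 1≤i j<ℓ

odd⇒⌊n/2⌋<n : ∀ n → n % 2 ≡ 1 → ⌊ n /2⌋ < n
odd⇒⌊n/2⌋<n zero    ()
odd⇒⌊n/2⌋<n (suc n) _ = ⌊n/2⌋<n n

lemma2 : ∀ {a : Level} {A : Set a} (S : List A)
    → (∀ i x → charAt S i ≡ just x → ∃ λ j → (j ≢ i) × (charAt S j ≡ just x))
    → (σ : A) (ℓ : ℕ) → 2 ≤ ℓ
    → (pos : ℕ → ℕ)
    → (∀ k → 1 ≤ k → k < ℓ → pos k < pos (suc k))
    → (∀ k → 1 ≤ k → k ≤ ℓ → charAt S (pos k) ≡ just σ)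
    → (∀ j → charAt S j ≡ just σ → ∃ λ k → (1 ≤ k) × (k ≤ ℓ) × (pos k ≡ j))
    → (Y : List A)
    → MaximalCommonSubseq Y (substrCO S (pos 1) (pos (suc ⌊ ℓ /2⌋))) (suffixFrom S (pos (suc ⌊ ℓ /2⌋)))
    → replicate ⌊ ℓ /2⌋ σ ⊆ Y
    → (¬ ((ℓ % 2 ≡ 1) × (Y ⊆ suffixFrom S (pos (suc (suc ⌊ ℓ /2⌋)))))
         → head Y ≡ just σ)
      × (ℓ % 2 ≡ 1 → Y ⊆ suffixFrom S (pos (suc (suc ⌊ ℓ /2⌋)))
         → ∀ Y′ → MaximalCommonSubseq Y′ (substrCO S (pos 1) (pos (suc (suc ⌊ ℓ /2⌋)))) (suffixFrom S (pos (suc (suc ⌊ ℓ /2⌋))))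
         → Y ⊆ Y′ → head Y′ ≡ just σ)
lemma2 S _ σ (suc (suc l)) (s≤s (s≤s z≤n)) pos inc occ _ Y mcs _ =
    -- suc (suc l) % 2 reduces to l % 2, so l-odd : l % 2 ≡ 1.
    (λ _ → head≡σ (⌊n/2⌋≤n l) mcs) , λ l-odd _ _ mcs′ _ → head≡σ (odd⇒⌊n/2⌋<n l l-odd) mcs′
  where
  1≤1 : 1 ≤ 1
  1≤1 = s≤s z≤n

  head≡σ : ∀ {k Z} → k ≤ l → MaximalCommonSubseq Z (substrCO S (pos 1) (pos (suc (suc k))))
                                                   (suffixFrom S (pos (suc (suc k))))
        → head Z ≡ just σ
  head≡σ k≤l = head-maximalCommonSubseq-between S
    (strictlyIncreasingOn⇒< inc 1≤1 (s≤s (s≤s z≤n)) (s≤s (s≤s k≤l)))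
    (occ 1 1≤1 (s≤s z≤n)) (occ _ (s≤s z≤n) (s≤s (s≤s k≤l)))
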